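{- Fix positive integers $n$, $r$, $s$. Let $\mathcal{A}$ be the set of all $(+K_3)$-graphs in $\mathcal{H}_v(2_{r-1}, 3; 4; n - s)$ with independence number at most $s$, and run the following procedure. For each $H \in \mathcal{A}$: compute the family $\mathcal{M}(H) = \{M_1, \dots, M_t\}$ of all maximal (under inclusion) subsets of $V(H)$ that induce a $K_3$-free subgraph; find all $s$-element subfamilies $N = \{M_{i_1}, \dots, M_{i_s}\}$ of $\mathcal{M}(H)$ such that (a) $M_{i_j} \neq N_H(v)$ for every $v \in V(H)$ and every $M_{i_j} \in N$; (b) the induced subgraph $H[M_{i_j} \cap M_{i_k}]$ contains an edge for every $M_{i_j}, M_{i_k} \in N$; (c) $\alpha(H - \bigcup_{M \in N'} M) \leq s - |N'|$ for every $N' \subseteq N$; for each such $N$ form the graph $G = G(N)$ by adding to $H$ new pairwise non-adjacent vertices $v_1, \dots, v_s$ with $N_G(v_j) = M_{i_j}$ for $j = 1, \dots, s$, and put $G$ into a set $\mathcal{B}$ if $G$ is not a Sperner graph and $\omega(G + e) = 4$ for every edge $e$ of $\overline{G}$. Then remove isomorphic copies from $\mathcal{B}$, and finally remove from $\mathcal{B}$ every graph $G$ with $G \not\overset{v}{\rightarrow} (2_r, 3)$. After this procedure, $\mathcal{B}$ coincides (up to isomorphism) with the set of all maximal non-Sperner graphs with independence number $s$ in $\mathcal{H}_v(2_r, 3; 4; n)$.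
   Context: All graphs are finite, simple and undirected; $\omega(G)$ is the clique number, $\alpha(G)$ the independence number, $\overline{G}$ the complement, $N_G(v)$ the neighborhood of $v$, $H[X]$ the subgraph induced by $X$, and $H - X$ the graph obtained by deleting the vertex set $X$. For positive integers $a_1, \dots, a_s$, $G \overset{v}{\rightarrow} (a_1, \dots, a_s)$ means that for every coloring of $V(G)$ in $s$ colors there is $i$ such that $G$ contains a clique on $a_i$ vertices all of color $i$. $\mathcal{H}_v(a_1, \dots, a_s; q; n)$ is the set of graphs $G$ on $n$ vertices with $G \overset{v}{\rightarrow} (a_1, \dots, a_s)$ and $\omega(G) < q$. The notation $2_r$ stands for $r$ copies of $2$ (so $(2_0, 3) = (3)$). A graph $G$ is a maximal graph in $\mathcal{H}_v(2_r, 3; 4; n)$ if $G \in \mathcal{H}_v(2_r, 3; 4; n)$ and $\omega(G + e) = 4$ for every edge $e$ of $\overline{G}$. A graph $H$ is a $(+K_3)$-graph if for every edge $e$ of $\overline{H}$, $H + e$ contains a $3$-clique not contained in $H$. A graph $G$ is a Sperner graph if $N_G(u) \subseteq N_G(v)$ for some pair of distinct vertices $u, v$. -}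

module Defs where

open import Data.Nat using (ℕ; zero; suc; _≤_; _<_; _∸_; _+_)
open import Data.Bool using (Bool; true; false; _∧_; _∨_)
open import Data.Fin using (Fin; zero; suc; splitAt)
open import Data.Fin.Subset using (Subset; _∈_; _∉_; _⊆_; ∣_∣; ∁; _∩_)
open import Data.Vec using (Vec; lookup; tabulate; replicate; _++_; _∷_; [])
open import Data.Sum using (_⊎_; inj₁; inj₂)
open import Data.Product using (Σ; ∃; _×_; _,_)
open import Function.Bundles using (_↔_; Inverse)
open import Function.Definitions using (Injective)
open import Relation.Binary.PropositionalEquality using (_≡_; _≢_; refl)
open import Relation.Nullary using (¬_)

record Graph (m : ℕ) : Set where
  field
    adj    : Fin m → Fin m → Bool
    sym    : ∀ x y → adj x y ≡ adj y x
    irrefl : ∀ x → adj x x ≡ false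
open Graph public

module _ {m : ℕ} (G : Graph m) where

  IsClique : Subset m → Set
  IsClique S = ∀ x y → x ∈ S → y ∈ S → x ≢ y → adj G x y ≡ true

  IsIndependent : Subset m → Set
  IsIndependent S = ∀ x y → x ∈ S → y ∈ S → adj G x y ≡ false

  ωLess : ℕ → Set
  ωLess q = ∀ S → IsClique S → ∣ S ∣ < q

  ωIs : ℕ → Set
  ωIs k = (Σ (Subset m) λ S → IsClique S × ∣ S ∣ ≡ k)
        × (∀ S → IsClique S → ∣ S ∣ ≤ k)

  αInLeq : Subset m → ℕ → Set
  αInLeq Y k = ∀ S → S ⊆ Y → IsIndependent S → ∣ S ∣ ≤ k

  αLeq : ℕ → Set
  αLeq k = ∀ S → IsIndependent S → ∣ S ∣ ≤ k

  αIs : ℕ → Set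
  αIs k = (Σ (Subset m) λ S → IsIndependent S × ∣ S ∣ ≡ k) × αLeq k

  nbhd : Fin m → Subset m
  nbhd v = tabulate (adj G v)

  Sperner : Set
  Sperner = Σ (Fin m) λ u → Σ (Fin m) λ v → u ≢ v × nbhd u ⊆ nbhd v

  Arrows : ∀ {t} → Vec ℕ t → Set
  Arrows {t} a = ∀ (c : Fin m → Fin t) →
    Σ (Fin t) λ i → Σ (Subset m) λ S →
      IsClique S × ∣ S ∣ ≡ lookup a i × (∀ x → x ∈ S → c x ≡ i)

  K3Free : Subset m → Set
  K3Free M = ∀ S → S ⊆ M → IsClique S → ¬ (∣ S ∣ ≡ 3)

  MaxK3Free : Subset m → Set
  MaxK3Free M = K3Free M × (∀ M′ → M ⊆ M′ → K3Free M′ → M′ ⊆ M)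

  HasEdgeIn : Subset m → Set
  HasEdgeIn X = Σ (Fin m) λ x → Σ (Fin m) λ y → x ∈ X × y ∈ X × adj G x y ≡ true

addEdge : ∀ {m} (G : Graph m) (u v : Fin m) → u ≢ v → Graph m
addEdge {m} G u v u≢v = record { adj = a ; sym = s ; irrefl = i }
  where
  open import Data.Fin using (_≟_)
  open import Relation.Nullary using (yes; no)
  e : Fin m → Fin m → Bool
  e x y with x ≟ u | y ≟ v
  ... | yes _ | yes _ = true
  ... | _     | _     = false
  a : Fin m → Fin m → Bool
  a x y = adj G x y ∨ (e x y ∨ e y x)
  open import Data.Bool.Properties using (∨-comm)
  open import Relation.Binary.PropositionalEquality using (cong₂; trans)
  s : ∀ x y → a x y ≡ a y x
  s x y = cong₂ _∨_ (sym G x y) (∨-comm (e x y) (e y x))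
  e-irr : ∀ x → e x x ≡ false
  e-irr x with x ≟ u | x ≟ v
  ... | yes refl | yes refl = Data.Empty.⊥-elim (u≢v refl)
    where import Data.Empty
  ... | yes _ | no _ = refl
  ... | no _ | yes _ = refl
  ... | no _ | no _ = refl
  i : ∀ x → a x x ≡ false
  i x rewrite irrefl G x | e-irr x = refl

AllNonEdgesω4 : ∀ {m} → Graph m → Set
AllNonEdgesω4 {m} G = ∀ (u v : Fin m) (u≢v : u ≢ v) → adj G u v ≡ false →
  ωIs (addEdge G u v u≢v) 4

PlusK3 : ∀ {m} → Graph m → Set
PlusK3 {m} H = ∀ (u v : Fin m) (u≢v : u ≢ v) → adj H u v ≡ false →
  Σ (Subset m) λ S → IsClique (addEdge H u v u≢v) S × ∣ S ∣ ≡ 3 × ¬ IsClique H S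

twos3 : (r : ℕ) → Vec ℕ (r + 1)
twos3 r = replicate r 2 ++ (3 ∷ [])

-- G ∈ H_v(a; q; m)   (the vertex count m is the index of Graph)
InHv : ∀ {m t} → Vec ℕ t → ℕ → Graph m → Set
InHv a q G = Arrows G a × ωLess G q

MaximalHv : ∀ {m} → ℕ → Graph m → Set
MaximalHv r G = InHv (twos3 r) 4 G × AllNonEdgesω4 G

-- The construction G(N): add to H (on m vertices) new pairwise
-- non-adjacent vertices v_1,…,v_s with N(v_j) = M_j.
-- Vertices of G(N) are Fin (m + s): the first m are V(H), the last s the v_j.

module _ {m s : ℕ} (H : Graph m) (M : Fin s → Subset m) where
  private
    eA : Fin m ⊎ Fin s → Fin m ⊎ Fin s → Bool
    eA (inj₁ x) (inj₁ y) = adj H x y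
    eA (inj₁ x) (inj₂ j) = lookup (M j) x
    eA (inj₂ j) (inj₁ x) = lookup (M j) x
    eA (inj₂ _) (inj₂ _) = false

    eA-sym : ∀ p q → eA p q ≡ eA q p
    eA-sym (inj₁ x) (inj₁ y) = sym H x y
    eA-sym (inj₁ x) (inj₂ j) = refl
    eA-sym (inj₂ j) (inj₁ x) = refl
    eA-sym (inj₂ _) (inj₂ _) = refl

    eA-irr : ∀ p → eA p p ≡ false
    eA-irr (inj₁ x) = irrefl H x
    eA-irr (inj₂ _) = refl

  extend : Graph (m + s)
  extend = record
    { adj    = λ x y → eA (splitAt m x) (splitAt m y)
    ; sym    = λ x y → eA-sym (splitAt m x) (splitAt m y)
    ; irrefl = λ x → eA-irr (splitAt m x)
    }

anyFin : ∀ {s} → (Fin s → Bool) → Bool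
anyFin {zero}  f = false
anyFin {suc s} f = f zero ∨ anyFin (λ j → f (suc j))

unionOver : ∀ {m s} → (Fin s → Subset m) → Subset s → Subset m
unionOver M I = tabulate (λ x → anyFin (λ j → lookup I j ∧ lookup (M j) x))

Iso : ∀ {a b} → Graph a → Graph b → Set
Iso {a} {b} G G′ = Σ (Fin a ↔ Fin b) λ f →
  ∀ x y → adj G′ (Inverse.to f x) (Inverse.to f y) ≡ adj G x y

InA : (n r s : ℕ) → Graph (n ∸ s) → Set
InA n r s H = PlusK3 H × InHv (twos3 (r ∸ 1)) 4 H × αLeq H s

-- N = {M_1,…,M_s} is an admissible s-element subfamily of 𝓜(H)
-- (given as an injective indexing Fin s → Subset m of distinct members)
Admissible : ∀ {m} (s : ℕ) → Graph m → (Fin s → Subset m) → Set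
Admissible {m} s H M =
    Injective _≡_ _≡_ M
  × (∀ j → MaxK3Free H (M j))
  × (∀ j (v : Fin m) → M j ≢ nbhd H v)
  × (∀ j k → HasEdgeIn H (M j ∩ M k))
  × (∀ (I : Subset s) → αInLeq H (∁ (unionOver M I)) (s ∸ ∣ I ∣))

Survives : ∀ {k} (r : ℕ) → Graph k → Set
Survives r G = ¬ Sperner G × AllNonEdgesω4 G × Arrows G (twos3 r)

Target : ∀ {n} (r s : ℕ) → Graph n → Set
Target r s G = MaximalHv r G × ¬ Sperner G × αIs G s

-- A clique of G(N) contains at most one v_j and then lies in M_j ∪ {v_j}, so ω(G(N)) < 4 as
-- soon as every M_j is K₃-free; an independent set of G(N) is S ∪ {v_j : j ∈ I} with S
-- disjoint from ⋃_{j ∈ I} M_j, so α(G(N)) = s is exactly condition (c). Conversely, a graph G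
-- with α(G) = s is isomorphic to G(N) for H = G − A, A an independent set of size s, and N the
-- neighbourhoods of the vertices of A. If ω(G) < 4 and ω(G + uv) = 4, then u and v have two
-- adjacent common neighbours; applied to the non-edges {x, v_j}, {v_j, v_k} and to the
-- non-edges of H this gives the maximality of M_j, condition (b) and the (+K₃) property of H.
-- A triangle in M_j would span a K₄ with v_j; non-Spernerness at the v_j is (a) together
-- with the distinctness of the M_j; and giving the new vertices an extra colour turns
-- G → (2_r, 3) into H → (2_{r-1}, 3). All notions involved are invariant under isomorphism.

module Submission where

open import Defs hiding (sym)

open import Data.Bool using (Bool; true; false; _∧_; _∨_; if_then_else_)
import Data.Bool as Bool
open import Data.Bool.Properties using (¬-not; ∨-zeroʳ; ⇔→≡)
open import Data.Fin using (Fin; zero; suc; _↑ˡ_; _↑ʳ_; splitAt; join; _≟_)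
import Data.Fin.Properties as Fin
open import Data.Fin.Permutation using (Permutation; _⟨$⟩ʳ_)
open import Data.Fin.Subset
open import Data.Fin.Subset.Properties
  using (∣∁p∣≡n∸∣p∣; ∪-identityˡ; nonempty?; Empty-unique; ∣⊥∣≡0; ∣⊤∣≡n; ∣p∣≤n; ∣⁅x⁆∣≡1; p─⊥≡p; p─q⊆p;
         _∈?_; ∉⊥;
         x∈p∪q⁺; x∈p∪q⁻; x∈p∩q⁺; x∈⁅x⁆; x∈⁅y⁆⇒x≡y; x∈∁p⇒x∉p; x∉p⇒x∈∁p)
open import Data.Nat using (ℕ; zero; suc; _+_; _∸_; _≤_; _<_; s≤s; z≤n; s≤s⁻¹; _≤?_)
open import Data.Nat.Properties
  using (+-0-commutativeMonoid; <⇒≢; ≤-trans; ≤-reflexive; n≤1+n; +-mono-≤; ≤∧≢⇒<; ≰⇒>; <-irrefl;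
         m≤o∸n⇒m+n≤o; m+n≤o⇒m≤o∸n; +-identityʳ; <⇒≤; m≤n⇒m∸n≡0; m∸n+n≡m)
open import Algebra.Properties.CommutativeMonoid.Sum +-0-commutativeMonoid using (sum; sum-permute; sum-cong-≗)
open import Data.Product using (Σ; ∃; ∃₂; _×_; _,_; proj₁; proj₂)
open import Data.Sum using (_⊎_; inj₁; inj₂; [_,_]′)
import Data.Sum as Sum
open import Data.Vec using (Vec; []; _∷_; here; there; lookup; tabulate; replicate; _++_)
import Data.Vec as Vec
open import Data.Vec.Properties using (lookup∘tabulate; []=⇒lookup; lookup⇒[]=; lookup-++ˡ; lookup-++ʳ)
open import Function.Base using (_∘_; const)
open import Function.Bundles using (_↔_; Inverse; Injection; mk↔ₛ′; mk⇔)
open import Function.Definitions using (Injective)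
open import Function.Properties.Inverse using (↔-refl; ↔-sym; ↔-trans; ↔⇒↣)
open import Relation.Binary.PropositionalEquality
open import Relation.Nullary using (¬_; yes; no; does; ¬?; _×-dec_; contradiction)
open import Relation.Nullary.Decidable using (decidable-stable)

private variable a b m n s : ℕ

-- Subsets of Fin n

∣p++q∣≡∣p∣+∣q∣ : (p : Subset m) (q : Subset n) → ∣ p ++ q ∣ ≡ ∣ p ∣ + ∣ q ∣
∣p++q∣≡∣p∣+∣q∣ []            q = refl
∣p++q∣≡∣p∣+∣q∣ (inside ∷ p)  q = cong suc (∣p++q∣≡∣p∣+∣q∣ p q)
∣p++q∣≡∣p∣+∣q∣ (outside ∷ p) q = ∣p++q∣≡∣p∣+∣q∣ p q

module _ {p : Subset m} {q : Subset n} where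

  ∈-++⁺ˡ : ∀ {x} → x ∈ p → x ↑ˡ n ∈ p ++ q
  ∈-++⁺ˡ {x} x∈p = lookup⇒[]= _ (p ++ q) (trans (lookup-++ˡ p q x) ([]=⇒lookup x∈p))

  ∈-++⁻ˡ : ∀ {x} → x ↑ˡ n ∈ p ++ q → x ∈ p
  ∈-++⁻ˡ {x} h = lookup⇒[]= x p (trans (sym (lookup-++ˡ p q x)) ([]=⇒lookup h))

  ∈-++⁺ʳ : ∀ {y} → y ∈ q → m ↑ʳ y ∈ p ++ q
  ∈-++⁺ʳ {y} y∈q = lookup⇒[]= _ (p ++ q) (trans (lookup-++ʳ p q y) ([]=⇒lookup y∈q))

  ∈-++⁻ʳ : ∀ {y} → m ↑ʳ y ∈ p ++ q → y ∈ q
  ∈-++⁻ʳ {y} h = lookup⇒[]= y q (trans (sym (lookup-++ʳ p q y)) ([]=⇒lookup h))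

Empty⇒∣p∣≡0 : (p : Subset n) → Empty p → ∣ p ∣ ≡ 0
Empty⇒∣p∣≡0 {n} p p-empty = trans (cong ∣_∣ (Empty-unique p-empty)) (∣⊥∣≡0 n)

⊥-empty : Empty (⊥ {n})
⊥-empty (_ , x∈⊥) = ∉⊥ x∈⊥

∣p++q∣≡∣p∣ : (p : Subset m) {q : Subset n} → Empty q → ∣ p ++ q ∣ ≡ ∣ p ∣
∣p++q∣≡∣p∣ p {q} q-empty =
  trans (∣p++q∣≡∣p∣+∣q∣ p q) (trans (cong (∣ p ∣ +_) (Empty⇒∣p∣≡0 q q-empty)) (+-identityʳ _))

nonempty-if-∣p∣>0 : (p : Subset n) → 0 < ∣ p ∣ → Nonempty p
nonempty-if-∣p∣>0 p 0<∣p∣ with nonempty? p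
... | yes ne = ne
... | no ¬ne = contradiction (Empty⇒∣p∣≡0 p ¬ne) (<⇒≢ 0<∣p∣ ∘ sym)

x∉p-x : ∀ (p : Subset n) x → x ∉ p - x
x∉p-x (_ ∷ p) zero    ()
x∉p-x (_ ∷ p) (suc x) (there x∈p-x) = x∉p-x p x x∈p-x

x∈p-y⇒x≢y : ∀ {p : Subset n} {x y} → x ∈ p - y → x ≢ y
x∈p-y⇒x≢y {p = p} x∈p-x refl = x∉p-x p _ x∈p-x

∣p∣≤1+∣p-x∣ : ∀ (p : Subset n) x → ∣ p ∣ ≤ suc ∣ p - x ∣
∣p∣≤1+∣p-x∣ (inside  ∷ p) zero    = s≤s (≤-reflexive (cong ∣_∣ (sym (p─⊥≡p p))))
∣p∣≤1+∣p-x∣ (outside ∷ p) zero    = ≤-trans (≤-reflexive (cong ∣_∣ (sym (p─⊥≡p p)))) (n≤1+n _)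
∣p∣≤1+∣p-x∣ (inside  ∷ p) (suc x) = s≤s (∣p∣≤1+∣p-x∣ p x)
∣p∣≤1+∣p-x∣ (outside ∷ p) (suc x) = ∣p∣≤1+∣p-x∣ p x

∣p∣≤2+∣p-x-y∣ : ∀ (p : Subset n) x y → ∣ p ∣ ≤ 2 + ∣ p - x - y ∣
∣p∣≤2+∣p-x-y∣ p x y = ≤-trans (∣p∣≤1+∣p-x∣ p x) (s≤s (∣p∣≤1+∣p-x∣ (p - x) y))

two-distinct : (p : Subset n) → 2 ≤ ∣ p ∣ → ∃₂ λ x y → x ∈ p × y ∈ p × x ≢ y
two-distinct p 2≤∣p∣ with nonempty-if-∣p∣>0 p (≤-trans (s≤s z≤n) 2≤∣p∣)
... | x , x∈p with nonempty-if-∣p∣>0 (p - x) (s≤s⁻¹ (≤-trans 2≤∣p∣ (∣p∣≤1+∣p-x∣ p x)))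
... | y , y∈p-x = x , y , x∈p , p─q⊆p p ⁅ x ⁆ y∈p-x , λ x≡y → x∈p-y⇒x≢y y∈p-x (sym x≡y)

AtMostOne : Subset n → Set
AtMostOne p = ∀ {x y} → x ∈ p → y ∈ p → x ≡ y

AtMostOne⇒∣p∣≤1 : (p : Subset n) → AtMostOne p → ∣ p ∣ ≤ 1
AtMostOne⇒∣p∣≤1 p p≤1 with ∣ p ∣ ≤? 1
... | yes ∣p∣≤1 = ∣p∣≤1
... | no  ∣p∣≰1 with two-distinct p (≰⇒> ∣p∣≰1)
...   | x , y , x∈p , y∈p , x≢y = contradiction (p≤1 x∈p y∈p) x≢y

⁅x⁆-atMostOne : ∀ (x : Fin n) → AtMostOne ⁅ x ⁆
⁅x⁆-atMostOne x a∈ b∈ = trans (x∈⁅y⁆⇒x≡y x a∈) (sym (x∈⁅y⁆⇒x≡y x b∈))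

∣⁅x⁆∪p∣ : ∀ (x : Fin n) {p} → x ∉ p → ∣ ⁅ x ⁆ ∪ p ∣ ≡ suc ∣ p ∣
∣⁅x⁆∪p∣ zero    {inside ∷ p}  x∉p = contradiction here x∉p
∣⁅x⁆∪p∣ zero    {outside ∷ p} _   = cong suc (cong ∣_∣ (∪-identityˡ p))
∣⁅x⁆∪p∣ (suc x) {inside ∷ p}  x∉p = cong suc (∣⁅x⁆∪p∣ x (x∉p ∘ there))
∣⁅x⁆∪p∣ (suc x) {outside ∷ p} x∉p = ∣⁅x⁆∪p∣ x (x∉p ∘ there)

indicator : Bool → ℕ
indicator b = if b then 1 else 0

∣p∣≡sum : (p : Subset n) → ∣ p ∣ ≡ sum (indicator ∘ lookup p)
∣p∣≡sum []            = refl
∣p∣≡sum (inside ∷ p)  = cong suc (∣p∣≡sum p)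
∣p∣≡sum (outside ∷ p) = ∣p∣≡sum p

preimage : (Fin m → Fin n) → Subset n → Subset m
preimage f p = tabulate (λ x → lookup p (f x))

∈-preimage⁻ : ∀ {f : Fin m → Fin n} {p x} → x ∈ preimage f p → f x ∈ p
∈-preimage⁻ {f = f} {p} {x} h = lookup⇒[]= (f x) p (trans (sym (lookup∘tabulate _ x)) ([]=⇒lookup h))

∣preimage∣ : (π : Permutation m n) (p : Subset n) → ∣ preimage (π ⟨$⟩ʳ_) p ∣ ≡ ∣ p ∣
∣preimage∣ {m} π p = begin
  ∣ preimage (π ⟨$⟩ʳ_) p ∣                           ≡⟨ ∣p∣≡sum (preimage (π ⟨$⟩ʳ_) p) ⟩
  sum {m} (indicator ∘ lookup (preimage (π ⟨$⟩ʳ_) p))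
    ≡⟨ sum-cong-≗ (cong indicator ∘ lookup∘tabulate (lookup p ∘ (π ⟨$⟩ʳ_))) ⟩
  sum {m} (indicator ∘ lookup p ∘ (π ⟨$⟩ʳ_))          ≡⟨ sum-permute _ π ⟨
  sum (indicator ∘ lookup p)                          ≡⟨ ∣p∣≡sum p ⟨
  ∣ p ∣                                               ∎
  where open ≡-Reasoning

separate : (p : Subset n) → Fin n → Fin ∣ ∁ p ∣ ⊎ Fin ∣ p ∣
separate (inside  ∷ p) zero    = inj₂ zero
separate (outside ∷ p) zero    = inj₁ zero
separate (inside  ∷ p) (suc x) = Sum.map₂ suc (separate p x)
separate (outside ∷ p) (suc x) = Sum.map₁ suc (separate p x)

merge : (p : Subset n) → Fin ∣ ∁ p ∣ ⊎ Fin ∣ p ∣ → Fin n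
merge (inside  ∷ p) (inj₂ zero)    = zero
merge (inside  ∷ p) (inj₂ (suc y)) = suc (merge p (inj₂ y))
merge (inside  ∷ p) (inj₁ x)       = suc (merge p (inj₁ x))
merge (outside ∷ p) (inj₁ zero)    = zero
merge (outside ∷ p) (inj₁ (suc x)) = suc (merge p (inj₁ x))
merge (outside ∷ p) (inj₂ y)       = suc (merge p (inj₂ y))

merge∘separate : ∀ (p : Subset n) x → merge p (separate p x) ≡ x
merge∘separate (inside  ∷ p) zero    = refl
merge∘separate (outside ∷ p) zero    = refl
merge∘separate (inside  ∷ p) (suc x) with separate p x | merge∘separate p x
... | inj₁ _ | eq = cong suc eq
... | inj₂ _ | eq = cong suc eq
merge∘separate (outside ∷ p) (suc x) with separate p x | merge∘separate p x
... | inj₁ _ | eq = cong suc eq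
... | inj₂ _ | eq = cong suc eq

separate∘merge : ∀ (p : Subset n) z → separate p (merge p z) ≡ z
separate∘merge (inside  ∷ p) (inj₂ zero)    = refl
separate∘merge (inside  ∷ p) (inj₂ (suc y)) = cong (Sum.map₂ suc) (separate∘merge p (inj₂ y))
separate∘merge (inside  ∷ p) (inj₁ x)       = cong (Sum.map₂ suc) (separate∘merge p (inj₁ x))
separate∘merge (outside ∷ p) (inj₁ zero)    = refl
separate∘merge (outside ∷ p) (inj₁ (suc x)) = cong (Sum.map₁ suc) (separate∘merge p (inj₁ x))
separate∘merge (outside ∷ p) (inj₂ y)       = cong (Sum.map₁ suc) (separate∘merge p (inj₂ y))

Fin↔∁p⊎p : (p : Subset n) → Fin n ↔ (Fin ∣ ∁ p ∣ ⊎ Fin ∣ p ∣)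
Fin↔∁p⊎p p = mk↔ₛ′ (separate p) (merge p) (separate∘merge p) (merge∘separate p)

merge-inside : ∀ (p : Subset n) y → merge p (inj₂ y) ∈ p
merge-inside (inside  ∷ p) zero    = here
merge-inside (inside  ∷ p) (suc y) = there (merge-inside p y)
merge-inside (outside ∷ p) y       = there (merge-inside p y)

anyFin⁺ : ∀ (f : Fin n → Bool) j → f j ≡ true → anyFin f ≡ true
anyFin⁺ f zero    fj≡true rewrite fj≡true = refl
anyFin⁺ f (suc j) fj≡true = trans (cong (f zero ∨_) (anyFin⁺ (f ∘ suc) j fj≡true)) (∨-zeroʳ (f zero))

anyFin⁻ : ∀ (f : Fin n → Bool) → anyFin f ≡ true → ∃ λ j → f j ≡ true
anyFin⁻ {suc n} f any≡true with f zero in f0≡b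
... | true  = zero , f0≡b
... | false = let j , fj≡true = anyFin⁻ (f ∘ suc) any≡true in suc j , fj≡true

module _ {M : Fin s → Subset m} {I : Subset s} where

  ∈unionOver⁺ : ∀ {x j} → j ∈ I → x ∈ M j → x ∈ unionOver M I
  ∈unionOver⁺ {x} {j} j∈I x∈Mj = lookup⇒[]= x _ (trans (lookup∘tabulate _ x)
    (anyFin⁺ _ j (cong₂ _∧_ ([]=⇒lookup j∈I) ([]=⇒lookup x∈Mj))))

  ∈unionOver⁻ : ∀ {x} → x ∈ unionOver M I → ∃ λ j → j ∈ I × x ∈ M j
  ∈unionOver⁻ {x} x∈∪ with anyFin⁻ _ (trans (sym (lookup∘tabulate _ x)) ([]=⇒lookup x∈∪))
  ... | j , j∈I∧x∈Mj with lookup I j in j∈I | lookup (M j) x in x∈Mj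
  ...   | true | true = j , lookup⇒[]= j I j∈I , lookup⇒[]= x (M j) x∈Mj

Subset0-unique : ∀ (p q : Subset 0) → p ≡ q
Subset0-unique [] [] = refl

injective⇒≤1 : ∀ {c} → c ≡ 0 → (M : Fin s → Subset c) → Injective _≡_ _≡_ M → s ≤ 1
injective⇒≤1 {zero}        _    _ _     = z≤n
injective⇒≤1 {suc zero}    _    _ _     = s≤s z≤n
injective⇒≤1 {suc (suc s)} refl M M-inj = contradiction (M-inj (Subset0-unique (M zero) (M (suc zero)))) λ ()

injective⇒s≤n : 1 ≤ n → (M : Fin s → Subset (n ∸ s)) → Injective _≡_ _≡_ M → s ≤ n
injective⇒s≤n {n} {s} 1≤n M M-inj with s ≤? n
... | yes s≤n = s≤n
... | no  s≰n = ≤-trans (injective⇒≤1 (m≤n⇒m∸n≡0 (<⇒≤ (≰⇒> s≰n))) M M-inj) 1≤n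

-- Cliques, triangles and adding an edge

module _ (G : Graph n) where

  ∈nbhd⁺ : ∀ {v w} → adj G v w ≡ true → w ∈ nbhd G v
  ∈nbhd⁺ {v} {w} h = lookup⇒[]= w _ (trans (lookup∘tabulate (adj G v) w) h)

  ∈nbhd⁻ : ∀ {v w} → w ∈ nbhd G v → adj G v w ≡ true
  ∈nbhd⁻ {v} {w} h = trans (sym (lookup∘tabulate (adj G v) w)) ([]=⇒lookup h)

  adj⇒≢ : ∀ {x y} → adj G x y ≡ true → x ≢ y
  adj⇒≢ {x} h refl = contradiction (trans (sym h) (irrefl G x)) λ ()

  adj-sym : ∀ {x y} → adj G x y ≡ true → adj G y x ≡ true
  adj-sym {x} {y} h = trans (Graph.sym G y x) h

  ⁅x⁆-clique : ∀ x → IsClique G ⁅ x ⁆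
  ⁅x⁆-clique x a b a∈ b∈ a≢b = contradiction (⁅x⁆-atMostOne x a∈ b∈) a≢b

  adj-⁅⁆ : ∀ {x y} → adj G x y ≡ true → ∀ z → z ∈ ⁅ y ⁆ → adj G x z ≡ true
  adj-⁅⁆ {x} {y} h z z∈y rewrite x∈⁅y⁆⇒x≡y y z∈y = h

  ⁅x⁆∪-clique : ∀ {x S} → IsClique G S → (∀ y → y ∈ S → adj G x y ≡ true) → IsClique G (⁅ x ⁆ ∪ S)
  ⁅x⁆∪-clique {x} {S} S-clique x~S a b a∈ b∈ a≢b with x∈p∪q⁻ ⁅ x ⁆ S a∈ | x∈p∪q⁻ ⁅ x ⁆ S b∈
  ... | inj₁ a∈⁅x⁆ | inj₁ b∈⁅x⁆ = ⁅x⁆-clique x a b a∈⁅x⁆ b∈⁅x⁆ a≢b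
  ... | inj₁ a∈⁅x⁆ | inj₂ b∈S   rewrite x∈⁅y⁆⇒x≡y x a∈⁅x⁆ = x~S b b∈S
  ... | inj₂ a∈S   | inj₁ b∈⁅x⁆ rewrite x∈⁅y⁆⇒x≡y x b∈⁅x⁆ = adj-sym (x~S a a∈S)
  ... | inj₂ a∈S   | inj₂ b∈S   = S-clique a b a∈S b∈S a≢b

triangle : Fin n → Fin n → Fin n → Subset n
triangle a b c = ⁅ a ⁆ ∪ ⁅ b ⁆ ∪ ⁅ c ⁆

∈triangle : ∀ {a b c x : Fin n} → x ∈ triangle a b c → x ≡ a ⊎ x ≡ b ⊎ x ≡ c
∈triangle {a = a} {b} {c} x∈ with x∈p∪q⁻ ⁅ a ⁆ _ x∈
... | inj₁ x∈a = inj₁ (x∈⁅y⁆⇒x≡y a x∈a)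
... | inj₂ x∈bc with x∈p∪q⁻ ⁅ b ⁆ ⁅ c ⁆ x∈bc
...   | inj₁ x∈b = inj₂ (inj₁ (x∈⁅y⁆⇒x≡y b x∈b))
...   | inj₂ x∈c = inj₂ (inj₂ (x∈⁅y⁆⇒x≡y c x∈c))

a∈triangle : ∀ (a b c : Fin n) → a ∈ triangle a b c
a∈triangle a b c = x∈p∪q⁺ (inj₁ (x∈⁅x⁆ a))

b∈triangle : ∀ (a b c : Fin n) → b ∈ triangle a b c
b∈triangle a b c = x∈p∪q⁺ (inj₂ (x∈p∪q⁺ (inj₁ (x∈⁅x⁆ b))))

triangle⊆ : ∀ {a b c : Fin n} {S} → a ∈ S → b ∈ S → c ∈ S → triangle a b c ⊆ S
triangle⊆ a∈S b∈S c∈S x∈ with ∈triangle x∈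
... | inj₁ refl        = a∈S
... | inj₂ (inj₁ refl) = b∈S
... | inj₂ (inj₂ refl) = c∈S

∣triangle∣ : ∀ {a b c : Fin n} → a ≢ b → a ≢ c → b ≢ c → ∣ triangle a b c ∣ ≡ 3
∣triangle∣ {a = a} {b} {c} a≢b a≢c b≢c = begin
  ∣ ⁅ a ⁆ ∪ ⁅ b ⁆ ∪ ⁅ c ⁆ ∣ ≡⟨ ∣⁅x⁆∪p∣ a a∉bc ⟩
  suc ∣ ⁅ b ⁆ ∪ ⁅ c ⁆ ∣     ≡⟨ cong suc (∣⁅x⁆∪p∣ b (b≢c ∘ x∈⁅y⁆⇒x≡y c)) ⟩
  2 + ∣ ⁅ c ⁆ ∣             ≡⟨ cong (2 +_) (∣⁅x⁆∣≡1 c) ⟩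
  3                         ∎
  where
  open ≡-Reasoning
  a∉bc : a ∉ ⁅ b ⁆ ∪ ⁅ c ⁆
  a∉bc a∈ with x∈p∪q⁻ ⁅ b ⁆ ⁅ c ⁆ a∈
  ... | inj₁ a∈b = a≢b (x∈⁅y⁆⇒x≡y b a∈b)
  ... | inj₂ a∈c = a≢c (x∈⁅y⁆⇒x≡y c a∈c)

module _ (G : Graph n) {a b c : Fin n} (ab : adj G a b ≡ true) (ac : adj G a c ≡ true) (bc : adj G b c ≡ true) where

  triangle-clique : IsClique G (triangle a b c)
  triangle-clique =
    ⁅x⁆∪-clique G (⁅x⁆∪-clique G (⁅x⁆-clique G c) (adj-⁅⁆ G bc))
      λ y y∈bc → [ adj-⁅⁆ G ab y , adj-⁅⁆ G ac y ]′ (x∈p∪q⁻ ⁅ b ⁆ ⁅ c ⁆ y∈bc)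

  ∣triangle∣≡3 : ∣ triangle a b c ∣ ≡ 3
  ∣triangle∣≡3 = ∣triangle∣ (adj⇒≢ G ab) (adj⇒≢ G ac) (adj⇒≢ G bc)

module _ (G : Graph n) {u v : Fin n} (u≢v : u ≢ v) where

  addEdge⁻ : ∀ {x y} → adj (addEdge G u v u≢v) x y ≡ true →
             adj G x y ≡ true ⊎ (x ≡ u × y ≡ v) ⊎ (x ≡ v × y ≡ u)
  addEdge⁻ {x} {y} h with adj G x y | x ≟ u | y ≟ v | y ≟ u | x ≟ v
  ... | true  | _        | _        | _        | _        = inj₁ refl
  ... | false | yes x≡u  | yes y≡v  | _        | _        = inj₂ (inj₁ (x≡u , y≡v))
  ... | false | _        | _        | yes y≡u  | yes x≡v  = inj₂ (inj₂ (x≡v , y≡u))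
  addEdge⁻ () | false | no _  | _     | no _  | _
  addEdge⁻ () | false | no _  | _     | yes _ | no _
  addEdge⁻ () | false | yes _ | no _  | no _  | _
  addEdge⁻ () | false | yes _ | no _  | yes _ | no _

  addEdge⁺ : ∀ {x y} → adj G x y ≡ true → adj (addEdge G u v u≢v) x y ≡ true
  addEdge⁺ {x} {y} h with adj G x y
  ... | true = refl

  addEdge-joins : adj (addEdge G u v u≢v) u v ≡ true
  addEdge-joins with adj G u v | u ≟ u | v ≟ v
  ... | true  | _       | _       = refl
  ... | false | yes _   | yes _   = refl
  ... | false | no u≢u  | _       = contradiction refl u≢u
  ... | false | yes _   | no v≢v  = contradiction refl v≢v

  addEdge-away : ∀ {w t} → w ≢ u → w ≢ v → adj (addEdge G u v u≢v) w t ≡ true → adj G w t ≡ true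
  addEdge-away w≢u w≢v h with addEdge⁻ h
  ... | inj₁ w~t              = w~t
  ... | inj₂ (inj₁ (w≡u , _)) = contradiction w≡u w≢u
  ... | inj₂ (inj₂ (w≡v , _)) = contradiction w≡v w≢v

  addEdge-clique⁻ : ∀ {K} → IsClique (addEdge G u v u≢v) K → u ∉ K ⊎ v ∉ K → IsClique G K
  addEdge-clique⁻ K-clique u∉K⊎v∉K x y x∈K y∈K x≢y with addEdge⁻ (K-clique x y x∈K y∈K x≢y) | u∉K⊎v∉K
  ... | inj₁ x~y               | _        = x~y
  ... | inj₂ (inj₁ (refl , _)) | inj₁ u∉K = contradiction x∈K u∉K
  ... | inj₂ (inj₁ (_ , refl)) | inj₂ v∉K = contradiction y∈K v∉K
  ... | inj₂ (inj₂ (_ , refl)) | inj₁ u∉K = contradiction y∈K u∉K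
  ... | inj₂ (inj₂ (refl , _)) | inj₂ v∉K = contradiction x∈K v∉K

data CommonEdge (G : Graph n) (u v : Fin n) : Set where
  commonEdge : ∀ {y z} → adj G y z ≡ true →
               adj G y u ≡ true → adj G y v ≡ true → adj G z u ≡ true → adj G z v ≡ true → CommonEdge G u v

module _ (G : Graph n) (ω<4 : ωLess G 4) {u v : Fin n} (u≢v : u ≢ v) where

  4-clique⇒commonEdge : ∀ {K} → IsClique (addEdge G u v u≢v) K → ∣ K ∣ ≡ 4 → CommonEdge G u v
  4-clique⇒commonEdge {K} K-clique ∣K∣≡4 with u ∈? K | v ∈? K
  ... | no u∉K | _      = contradiction (ω<4 K (addEdge-clique⁻ G u≢v K-clique (inj₁ u∉K))) (<-irrefl ∣K∣≡4)
  ... | _      | no v∉K = contradiction (ω<4 K (addEdge-clique⁻ G u≢v K-clique (inj₂ v∉K))) (<-irrefl ∣K∣≡4)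
  ... | yes u∈K | yes v∈K
        with two-distinct (K - u - v)
               (s≤s⁻¹ (s≤s⁻¹ (subst (_≤ 2 + ∣ K - u - v ∣) ∣K∣≡4 (∣p∣≤2+∣p-x-y∣ K u v))))
  ... | y , z , y∈ , z∈ , y≢z = commonEdge
    (adjacent y∈ z (K∖uv⊆K z∈) y≢z)
    (adjacent y∈ u u∈K (K∖uv≢u y∈)) (adjacent y∈ v v∈K (K∖uv≢v y∈))
    (adjacent z∈ u u∈K (K∖uv≢u z∈)) (adjacent z∈ v v∈K (K∖uv≢v z∈))
    where
    K∖uv⊆K : K - u - v ⊆ K
    K∖uv⊆K = p─q⊆p K ⁅ u ⁆ ∘ p─q⊆p (K - u) ⁅ v ⁆
    K∖uv≢u : ∀ {w} → w ∈ K - u - v → w ≢ u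
    K∖uv≢u = x∈p-y⇒x≢y ∘ p─q⊆p (K - u) ⁅ v ⁆
    K∖uv≢v : ∀ {w} → w ∈ K - u - v → w ≢ v
    K∖uv≢v = x∈p-y⇒x≢y
    adjacent : ∀ {w} → w ∈ K - u - v → ∀ t → t ∈ K → w ≢ t → adj G w t ≡ true
    adjacent w∈ t t∈K w≢t = addEdge-away G u≢v (K∖uv≢u w∈) (K∖uv≢v w∈) (K-clique _ t (K∖uv⊆K w∈) t∈K w≢t)

module _ {G : Graph n} (ω<4 : ωLess G 4) (saturated : AllNonEdgesω4 G) where

  nonEdge⇒commonEdge : ∀ {u v} → u ≢ v → adj G u v ≡ false → CommonEdge G u v
  nonEdge⇒commonEdge u≢v u≁v with saturated _ _ u≢v u≁v
  ... | (K , K-clique , ∣K∣≡4) , _ = 4-clique⇒commonEdge G ω<4 u≢v K-clique ∣K∣≡4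

0<twos3 : ∀ r i → 0 < lookup (twos3 r) i
0<twos3 zero    zero    = s≤s z≤n
0<twos3 (suc r) zero    = s≤s z≤n
0<twos3 (suc r) (suc i) = 0<twos3 r i

module _ {G : Graph n} (ω<4 : ωLess G 4) {r} (G→2ᵣ₊₁3 : Arrows G (twos3 (suc r))) (w : Fin n) where

  private
    lastColour : Fin (suc r + 1)
    lastColour = suc r ↑ʳ zero

    colouring : Fin n → Fin (suc r + 1)
    colouring v = if does (v ≟ w) then zero else lastColour

    colouring-w : colouring w ≡ zero
    colouring-w with w ≟ w
    ... | yes _   = refl
    ... | no w≢w = contradiction refl w≢w

    colouring-other : ∀ {v} → v ≢ w → colouring v ≡ lastColour
    colouring-other {v} v≢w with v ≟ w
    ... | yes v≡w = contradiction v≡w v≢w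
    ... | no _    = refl

    colouring-zero : ∀ {v} → colouring v ≡ zero → v ≡ w
    colouring-zero {v} c≡0 with v ≟ w
    ... | yes v≡w = v≡w
    colouring-zero () | no _

  -- Colour w alone with a 2-colour and every other vertex with the 3-colour: the
  -- monochromatic clique must be a triangle avoiding w, which w would extend to a K₄.
  not-dominating : ¬ (∀ v → v ≢ w → adj G w v ≡ true)
  not-dominating w~all with G→2ᵣ₊₁3 colouring
  ... | i , S , S-clique , ∣S∣≡aᵢ , S-coloured-i
      with nonempty-if-∣p∣>0 S (subst (0 <_) (sym ∣S∣≡aᵢ) (0<twos3 (suc r) i))
  ...   | x , x∈S with x ≟ w
  ...     | yes refl with trans (sym (S-coloured-i x x∈S)) colouring-w
  ...       | refl with two-distinct S (≤-reflexive (sym ∣S∣≡aᵢ))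
  ...         | y , z , y∈S , z∈S , y≢z =
    y≢z (trans (colouring-zero (S-coloured-i y y∈S)) (sym (colouring-zero (S-coloured-i z z∈S))))
  not-dominating w~all | i , S , S-clique , ∣S∣≡aᵢ , S-coloured-i | x , x∈S | no x≢w
      with trans (sym (S-coloured-i x x∈S)) (colouring-other x≢w)
  ...   | refl = <-irrefl ∣⁅w⁆∪S∣≡4 (ω<4 (⁅ w ⁆ ∪ S) (⁅x⁆∪-clique G S-clique w~S))
    where
    w∉S : w ∉ S
    w∉S w∈S with trans (sym (S-coloured-i w w∈S)) colouring-w
    ... | ()
    w~S : ∀ y → y ∈ S → adj G w y ≡ true
    w~S y y∈S = w~all y λ y≡w → w∉S (subst (_∈ S) y≡w y∈S)
    ∣⁅w⁆∪S∣≡4 : ∣ ⁅ w ⁆ ∪ S ∣ ≡ 4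
    ∣⁅w⁆∪S∣≡4 =
      trans (∣⁅x⁆∪p∣ w w∉S) (cong suc (trans ∣S∣≡aᵢ (lookup-++ʳ (replicate (suc r) 2) (3 ∷ []) zero)))

  nonNeighbour : ∃ λ v → v ≢ w × adj G w v ≡ false
  nonNeighbour with Fin.any? (λ v → ¬? (v ≟ w) ×-dec (adj G w v Bool.≟ false))
  ... | yes found = found
  ... | no none   = contradiction (λ v v≢w → ¬-not λ w≁v → none (v , v≢w , w≁v)) not-dominating

-- Invariance under isomorphism

Iso-sym : {G : Graph a} {G′ : Graph b} → Iso G G′ → Iso G′ G
Iso-sym {G = G} {G′} (f , f-adj) = ↔-sym f , λ x y → begin
  adj G (from x) (from y)           ≡⟨ f-adj (from x) (from y) ⟨
  adj G′ (to (from x)) (to (from y)) ≡⟨ cong₂ (adj G′) (strictlyInverseˡ x) (strictlyInverseˡ y) ⟩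
  adj G′ x y                         ∎
  where
  open Inverse f
  open ≡-Reasoning

Iso-cast : m ≡ n → (G : Graph m) → Σ (Graph n) (Iso G)
Iso-cast refl G = G , ↔-refl , λ _ _ → refl

module Pullback {G : Graph a} {G′ : Graph b} (iso : Iso G G′) where

  open Inverse (proj₁ iso) using (to)

  pull : Subset b → Subset a
  pull = preimage to

  ∣pull∣ : ∀ S → ∣ pull S ∣ ≡ ∣ S ∣
  ∣pull∣ = ∣preimage∣ (proj₁ iso)

  pull-clique : ∀ {S} → IsClique G′ S → IsClique G (pull S)
  pull-clique S-clique x y x∈ y∈ x≢y = trans (sym (proj₂ iso x y))
    (S-clique _ _ (∈-preimage⁻ x∈) (∈-preimage⁻ y∈) (x≢y ∘ Injection.injective (↔⇒↣ (proj₁ iso))))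

  pull-independent : ∀ {S} → IsIndependent G′ S → IsIndependent G (pull S)
  pull-independent S-indep x y x∈ y∈ = trans (sym (proj₂ iso x y)) (S-indep _ _ (∈-preimage⁻ x∈) (∈-preimage⁻ y∈))

module _ {G : Graph a} {G′ : Graph b} (iso : Iso G G′) where

  open Inverse (proj₁ iso)
  open Pullback {G = G} {G′} iso

  private
    to-injective : ∀ {x y} → to x ≡ to y → x ≡ y
    to-injective = Injection.injective (↔⇒↣ (proj₁ iso))

  private module Push = Pullback {G = G′} {G} (Iso-sym {G = G} {G′} iso)

  ωLess-resp-Iso : ∀ {q} → ωLess G q → ωLess G′ q
  ωLess-resp-Iso ω<q S S-clique = subst (_< _) (∣pull∣ S) (ω<q (pull S) (pull-clique S-clique))

  ωIs-resp-Iso : ∀ {k} → ωIs G k → ωIs G′ k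
  ωIs-resp-Iso ((S , S-clique , ∣S∣≡k) , ω≤k) =
    (Push.pull S , Push.pull-clique S-clique , trans (Push.∣pull∣ S) ∣S∣≡k) ,
    λ S′ S′-clique → subst (_≤ _) (∣pull∣ S′) (ω≤k (pull S′) (pull-clique S′-clique))

  αLeq-resp-Iso : ∀ {k} → αLeq G k → αLeq G′ k
  αLeq-resp-Iso α≤k S S-indep = subst (_≤ _) (∣pull∣ S) (α≤k (pull S) (pull-independent S-indep))

  αIs-resp-Iso : ∀ {k} → αIs G k → αIs G′ k
  αIs-resp-Iso ((S , S-indep , ∣S∣≡k) , α≤k) =
    (Push.pull S , Push.pull-independent S-indep , trans (Push.∣pull∣ S) ∣S∣≡k) , αLeq-resp-Iso α≤k

  Arrows-resp-Iso : ∀ {t} {av : Vec ℕ t} → Arrows G av → Arrows G′ av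
  Arrows-resp-Iso G→av c with G→av (c ∘ to)
  ... | i , S , S-clique , ∣S∣≡aᵢ , S-coloured-i =
    i , Push.pull S , Push.pull-clique S-clique , trans (Push.∣pull∣ S) ∣S∣≡aᵢ ,
    λ x x∈ → trans (cong c (sym (strictlyInverseˡ x))) (S-coloured-i _ (∈-preimage⁻ x∈))

  Sperner-resp-Iso : Sperner G → Sperner G′
  Sperner-resp-Iso (u , v , u≢v , Nu⊆Nv) = to u , to v , u≢v ∘ to-injective , λ {w} w∈ →
    ∈nbhd⁺ G′ (trans (adj-to-from v w)
      (∈nbhd⁻ G (Nu⊆Nv (∈nbhd⁺ G (trans (sym (adj-to-from u w)) (∈nbhd⁻ G′ w∈))))))
    where
    adj-to-from : ∀ x w → adj G′ (to x) w ≡ adj G x (from w)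
    adj-to-from x w = trans (cong (adj G′ (to x)) (sym (strictlyInverseˡ w))) (proj₂ iso x (from w))

  addEdge-resp-Iso : ∀ {u v} (u≢v : u ≢ v) (u≢v′ : to u ≢ to v) →
                     Iso (addEdge G u v u≢v) (addEdge G′ (to u) (to v) u≢v′)
  addEdge-resp-Iso {u} {v} u≢v u≢v′ = proj₁ iso , λ x y → ⇔→≡ (mk⇔ (forth x y) (back x y))
    where
    forth : ∀ x y → adj (addEdge G′ (to u) (to v) u≢v′) (to x) (to y) ≡ true → adj (addEdge G u v u≢v) x y ≡ true
    forth x y h with addEdge⁻ G′ u≢v′ h
    ... | inj₁ x~y = addEdge⁺ G u≢v (trans (sym (proj₂ iso x y)) x~y)
    ... | inj₂ (inj₁ (x≡u , y≡v)) rewrite to-injective x≡u | to-injective y≡v = addEdge-joins G u≢v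
    ... | inj₂ (inj₂ (x≡v , y≡u)) rewrite to-injective x≡v | to-injective y≡u =
      adj-sym (addEdge G u v u≢v) (addEdge-joins G u≢v)
    back : ∀ x y → adj (addEdge G u v u≢v) x y ≡ true → adj (addEdge G′ (to u) (to v) u≢v′) (to x) (to y) ≡ true
    back x y h with addEdge⁻ G u≢v h
    ... | inj₁ x~y = addEdge⁺ G′ u≢v′ (trans (proj₂ iso x y) x~y)
    ... | inj₂ (inj₁ (refl , refl)) = addEdge-joins G′ u≢v′
    ... | inj₂ (inj₂ (refl , refl)) = adj-sym (addEdge G′ (to u) (to v) u≢v′) (addEdge-joins G′ u≢v′)

module _ {G : Graph a} {G′ : Graph b} (iso : Iso G G′) where

  open Inverse (proj₁ iso)

  private
    iso⁻¹ : Iso G′ G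
    iso⁻¹ = Iso-sym {G = G} {G′} iso

  AllNonEdgesω4-resp-Iso : AllNonEdgesω4 G → AllNonEdgesω4 G′
  AllNonEdgesω4-resp-Iso saturated u v u≢v u≁v =
    ωIs-resp-Iso {G = addEdge G (from u) (from v) u≢v′} {addEdge G′ u v u≢v}
      (Iso-sym {G = addEdge G′ u v u≢v} {addEdge G (from u) (from v) u≢v′}
        (addEdge-resp-Iso {G = G′} {G} iso⁻¹ u≢v u≢v′))
      (saturated (from u) (from v) u≢v′ (trans (proj₂ iso⁻¹ u v) u≁v))
    where
    u≢v′ : from u ≢ from v
    u≢v′ = u≢v ∘ Injection.injective (↔⇒↣ (↔-sym (proj₁ iso)))

  Target-resp-Iso : ∀ {r s} → Target r s G → Target r s G′
  Target-resp-Iso {r} (((G→2ᵣ3 , ω<4) , saturated) , ¬sperner , α≡s) =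
    ((Arrows-resp-Iso {G = G} {G′} iso {av = twos3 r} G→2ᵣ3 , ωLess-resp-Iso {G = G} {G′} iso ω<4) ,
      AllNonEdgesω4-resp-Iso saturated) ,
    ¬sperner ∘ Sperner-resp-Iso {G = G′} {G} iso⁻¹ , αIs-resp-Iso {G = G} {G′} iso α≡s

-- The graph G(N)

target⇒survives : ∀ {r s} {G : Graph n} → Target r s G → Survives r G
target⇒survives (((G→2ᵣ3 , _) , saturated) , ¬sperner , _) = ¬sperner , saturated , G→2ᵣ3

module Extension {m s} (H : Graph m) (M : Fin s → Subset m) where

  E : Graph (m + s)
  E = extend H M

  old : Fin m → Fin (m + s)
  old x = x ↑ˡ s

  new : Fin s → Fin (m + s)
  new j = m ↑ʳ j

  adj-old-old : ∀ x y → adj E (old x) (old y) ≡ adj H x y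
  adj-old-old x y rewrite Fin.splitAt-↑ˡ m x s | Fin.splitAt-↑ˡ m y s = refl

  adj-old-new : ∀ x j → adj E (old x) (new j) ≡ lookup (M j) x
  adj-old-new x j rewrite Fin.splitAt-↑ˡ m x s | Fin.splitAt-↑ʳ m s j = refl

  adj-new-old : ∀ j x → adj E (new j) (old x) ≡ lookup (M j) x
  adj-new-old j x rewrite Fin.splitAt-↑ˡ m x s | Fin.splitAt-↑ʳ m s j = refl

  adj-new-new : ∀ j k → adj E (new j) (new k) ≡ false
  adj-new-new j k rewrite Fin.splitAt-↑ʳ m s j | Fin.splitAt-↑ʳ m s k = refl

  data Vertex : Fin (m + s) → Set where
    old′ : ∀ x → Vertex (old x)
    new′ : ∀ j → Vertex (new j)

  vertex : ∀ z → Vertex z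
  vertex z with splitAt m z in eq
  ... | inj₁ x = subst Vertex (Fin.splitAt⁻¹-↑ˡ eq) (old′ x)
  ... | inj₂ j = subst Vertex (Fin.splitAt⁻¹-↑ʳ eq) (new′ j)

  new-injective : ∀ {j k} → new j ≡ new k → j ≡ k
  new-injective = Fin.↑ʳ-injective m _ _

  old≢new : ∀ x j → old x ≢ new j
  old≢new x j eq with trans (sym (Fin.splitAt-↑ˡ m x s)) (trans (cong (splitAt m) eq) (Fin.splitAt-↑ʳ m s j))
  ... | ()

  module _ {P : Subset m} {Q : Subset s} where

    clique⁺ : IsClique H P → AtMostOne Q → (∀ {x j} → x ∈ P → j ∈ Q → x ∈ M j) → IsClique E (P ++ Q)
    clique⁺ P-clique Q≤1 P⊆M z w z∈ w∈ z≢w with vertex z | vertex w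
    ... | old′ x | old′ y = trans (adj-old-old x y) (P-clique x y (∈-++⁻ˡ z∈) (∈-++⁻ˡ w∈) (z≢w ∘ cong old))
    ... | old′ x | new′ k = trans (adj-old-new x k) ([]=⇒lookup (P⊆M (∈-++⁻ˡ z∈) (∈-++⁻ʳ w∈)))
    ... | new′ j | old′ y = trans (adj-new-old j y) ([]=⇒lookup (P⊆M (∈-++⁻ˡ w∈) (∈-++⁻ʳ z∈)))
    ... | new′ j | new′ k = contradiction (cong new (Q≤1 (∈-++⁻ʳ z∈) (∈-++⁻ʳ w∈))) z≢w

    clique⁻ : IsClique E (P ++ Q) → IsClique H P × AtMostOne Q × (∀ {x j} → x ∈ P → j ∈ Q → x ∈ M j)
    clique⁻ PQ-clique = P-clique , Q≤1 , P⊆M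
      where
      P-clique : IsClique H P
      P-clique x y x∈ y∈ x≢y =
        trans (sym (adj-old-old x y)) (PQ-clique _ _ (∈-++⁺ˡ x∈) (∈-++⁺ˡ y∈) (x≢y ∘ Fin.↑ˡ-injective s x y))
      Q≤1 : AtMostOne Q
      Q≤1 {j} {k} j∈ k∈ = decidable-stable (j ≟ k) λ j≢k → contradiction
        (trans (sym (PQ-clique _ _ (∈-++⁺ʳ j∈) (∈-++⁺ʳ k∈) (j≢k ∘ new-injective))) (adj-new-new j k)) λ ()
      P⊆M : ∀ {x j} → x ∈ P → j ∈ Q → x ∈ M j
      P⊆M {x} {j} x∈ j∈ = lookup⇒[]= x (M j)
        (trans (sym (adj-old-new x j)) (PQ-clique _ _ (∈-++⁺ˡ x∈) (∈-++⁺ʳ j∈) (old≢new x j)))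

    independent⁺ : IsIndependent H P → (∀ {x j} → x ∈ P → j ∈ Q → x ∉ M j) → IsIndependent E (P ++ Q)
    independent⁺ P-indep P∩M=∅ z w z∈ w∈ with vertex z | vertex w
    ... | old′ x | old′ y = trans (adj-old-old x y) (P-indep x y (∈-++⁻ˡ z∈) (∈-++⁻ˡ w∈))
    ... | old′ x | new′ k = trans (adj-old-new x k) (¬-not (P∩M=∅ (∈-++⁻ˡ z∈) (∈-++⁻ʳ w∈) ∘ lookup⇒[]= x (M k)))
    ... | new′ j | old′ y = trans (adj-new-old j y) (¬-not (P∩M=∅ (∈-++⁻ˡ w∈) (∈-++⁻ʳ z∈) ∘ lookup⇒[]= y (M j)))
    ... | new′ j | new′ k = adj-new-new j k

    independent⁻ : IsIndependent E (P ++ Q) → IsIndependent H P × (∀ {x j} → x ∈ P → j ∈ Q → x ∉ M j)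
    independent⁻ PQ-indep =
      (λ x y x∈ y∈ → trans (sym (adj-old-old x y)) (PQ-indep _ _ (∈-++⁺ˡ x∈) (∈-++⁺ˡ y∈))) ,
      λ {x} {j} x∈ j∈ x∈Mj → contradiction
        (trans (sym ([]=⇒lookup x∈Mj)) (trans (sym (adj-old-new x j)) (PQ-indep _ _ (∈-++⁺ˡ x∈) (∈-++⁺ʳ j∈)))) λ ()

  ωLess-extend : ωLess H 4 → (∀ j → K3Free H (M j)) → ωLess E 4
  ωLess-extend ω<4 Mⱼ-K3-free S S-clique with Vec.splitAt m S
  ... | P , Q , refl with clique⁻ S-clique
  ...   | P-clique , Q≤1 , P⊆M with nonempty? Q
  ...     | no Q-empty = subst (_< 4) (sym (∣p++q∣≡∣p∣ P Q-empty)) (ω<4 P P-clique)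
  ...     | yes (j , j∈Q) = subst (_< 4) (sym (∣p++q∣≡∣p∣+∣q∣ P Q)) (+-mono-≤ ∣P∣<3 (AtMostOne⇒∣p∣≤1 Q Q≤1))
    where
    ∣P∣<3 : ∣ P ∣ < 3
    ∣P∣<3 = ≤∧≢⇒< (s≤s⁻¹ (ω<4 P P-clique)) (Mⱼ-K3-free j P (λ x∈P → P⊆M x∈P j∈Q) P-clique)

  αIs-extend : (∀ (I : Subset s) → αInLeq H (∁ (unionOver M I)) (s ∸ ∣ I ∣)) → αIs E s
  αIs-extend α-bound = (⊥ {m} ++ ⊤ {s} , new-vertices-independent , ∣new-vertices∣) , α≤s
    where
    new-vertices-independent : IsIndependent E (⊥ {m} ++ ⊤ {s})
    new-vertices-independent = independent⁺ (λ _ _ x∈⊥ → contradiction x∈⊥ ∉⊥) (λ x∈⊥ → contradiction x∈⊥ ∉⊥)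
    ∣new-vertices∣ : ∣ ⊥ {m} ++ ⊤ {s} ∣ ≡ s
    ∣new-vertices∣ = trans (∣p++q∣≡∣p∣+∣q∣ (⊥ {m}) (⊤ {s})) (cong₂ _+_ (∣⊥∣≡0 m) (∣⊤∣≡n s))
    α≤s : αLeq E s
    α≤s S S-indep with Vec.splitAt m S
    ... | P , Q , refl with independent⁻ S-indep
    ...   | P-indep , P∩M=∅ = subst (_≤ s) (sym (∣p++q∣≡∣p∣+∣q∣ P Q))
      (m≤o∸n⇒m+n≤o ∣ P ∣ (∣p∣≤n Q) (α-bound Q P P⊆∁∪M P-indep))
      where
      P⊆∁∪M : P ⊆ ∁ (unionOver M Q)
      P⊆∁∪M x∈P = x∉p⇒x∈∁p λ x∈∪ →
        let j , j∈Q , x∈Mj = ∈unionOver⁻ {M = M} x∈∪ in P∩M=∅ x∈P j∈Q x∈Mj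

  ωLess-restrict : ∀ {q} → ωLess E q → ωLess H q
  ωLess-restrict ω<q P P-clique = subst (_< _) (∣p++q∣≡∣p∣ P ⊥-empty)
    (ω<q (P ++ ⊥) (clique⁺ P-clique (λ j∈⊥ → contradiction j∈⊥ ∉⊥) (λ _ j∈⊥ → contradiction j∈⊥ ∉⊥)))

  αLeq-restrict : ∀ {k} → αLeq E k → αLeq H k
  αLeq-restrict α≤k P P-indep = subst (_≤ _) (∣p++q∣≡∣p∣ P ⊥-empty)
    (α≤k (P ++ ⊥) (independent⁺ P-indep (λ _ j∈⊥ → contradiction j∈⊥ ∉⊥)))

  module _ {t} (c : Fin m → Fin t) where

    liftColouring : Fin (m + s) → Fin (suc t)
    liftColouring z = [ suc ∘ c , const zero ]′ (splitAt m z)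

    liftColouring-old : ∀ x → liftColouring (old x) ≡ suc (c x)
    liftColouring-old x rewrite Fin.splitAt-↑ˡ m x s = refl

    liftColouring-new : ∀ j → liftColouring (new j) ≡ zero
    liftColouring-new j rewrite Fin.splitAt-↑ʳ m s j = refl

  -- The new vertices are independent, so the fresh colour zero (asking for a 2-clique)
  -- can never be the monochromatic one.
  Arrows-restrict : ∀ {t} {av : Vec ℕ t} → Arrows E (2 ∷ av) → Arrows H av
  Arrows-restrict {av = av} E→2av c with E→2av (liftColouring c)
  ... | zero , S , S-clique , ∣S∣≡2 , S-coloured-0 with two-distinct S (≤-reflexive (sym ∣S∣≡2))
  ...   | z , w , z∈S , w∈S , z≢w with vertex z | vertex w | S-coloured-0 z z∈S | S-coloured-0 w w∈S
  ...     | old′ x | _      | x-coloured-0 | _ = contradiction (trans (sym (liftColouring-old c x)) x-coloured-0) λ ()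
  ...     | new′ _ | old′ y | _ | y-coloured-0 = contradiction (trans (sym (liftColouring-old c y)) y-coloured-0) λ ()
  ...     | new′ j | new′ k | _ | _ = contradiction (trans (sym (S-clique _ _ z∈S w∈S z≢w)) (adj-new-new j k)) λ ()
  Arrows-restrict {av = av} E→2av c | suc i , S , S-clique , ∣S∣≡aᵢ , S-coloured-i with Vec.splitAt m S
  ... | P , Q , refl =
    i , P , proj₁ (clique⁻ S-clique) , trans (sym (∣p++q∣≡∣p∣ P Q-empty)) ∣S∣≡aᵢ ,
    λ x x∈P → Fin.suc-injective (trans (sym (liftColouring-old c x)) (S-coloured-i _ (∈-++⁺ˡ x∈P)))
    where
    Q-empty : Empty Q
    Q-empty (j , j∈Q) = contradiction (trans (sym (liftColouring-new c j)) (S-coloured-i _ (∈-++⁺ʳ j∈Q))) λ ()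

  commonEdge-old : ∀ {u v} → CommonEdge E (old u) (old v) → ∃ λ w → adj H w u ≡ true × adj H w v ≡ true
  commonEdge-old {u} {v} (commonEdge {y} {z} y~z y~u y~v z~u z~v) with vertex y | vertex z
  ... | old′ y′ | _       = y′ , trans (sym (adj-old-old y′ u)) y~u , trans (sym (adj-old-old y′ v)) y~v
  ... | new′ _  | old′ z′ = z′ , trans (sym (adj-old-old z′ u)) z~u , trans (sym (adj-old-old z′ v)) z~v
  ... | new′ j  | new′ k  = contradiction (trans (sym y~z) (adj-new-new j k)) λ ()

  PlusK3-restrict : ωLess E 4 → AllNonEdgesω4 E → PlusK3 H
  PlusK3-restrict ω<4 saturated u v u≢v u≁v with commonEdge-old (nonEdge⇒commonEdge ω<4 saturated
      (u≢v ∘ Fin.↑ˡ-injective s u v) (trans (adj-old-old u v) u≁v))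
  ... | w , w~u , w~v = triangle u v w ,
    triangle-clique (addEdge H u v u≢v) (addEdge-joins H u≢v)
      (addEdge⁺ H u≢v (adj-sym H w~u)) (addEdge⁺ H u≢v (adj-sym H w~v)) ,
    ∣triangle∣ u≢v (adj⇒≢ H w~u ∘ sym) (adj⇒≢ H w~v ∘ sym) ,
    λ uvw-clique → contradiction (trans (sym (uvw-clique u v (a∈triangle u v w) (b∈triangle u v w) u≢v)) u≁v) λ ()

  commonEdge-new : ∀ {u j} → CommonEdge E u (new j) →
    ∃₂ λ y z → adj H y z ≡ true × y ∈ M j × z ∈ M j × adj E (old y) u ≡ true × adj E (old z) u ≡ true
  commonEdge-new {u} {j} (commonEdge {y} {z} y~z y~u y~j z~u z~j) with vertex y | vertex z
  ... | old′ y′ | old′ z′ = y′ , z′ , trans (sym (adj-old-old y′ z′)) y~z ,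
    lookup⇒[]= y′ (M j) (trans (sym (adj-old-new y′ j)) y~j) , lookup⇒[]= z′ (M j) (trans (sym (adj-old-new z′ j)) z~j) ,
    y~u , z~u
  ... | new′ k | _      = contradiction (trans (sym y~j) (adj-new-new k j)) λ ()
  ... | old′ _ | new′ k = contradiction (trans (sym z~j) (adj-new-new k j)) λ ()

  nbhd-new⊆ : ∀ {j z} → (∀ {x} → x ∈ M j → old x ∈ nbhd E z) → nbhd E (new j) ⊆ nbhd E z
  nbhd-new⊆ {j} {z} Mj⊆Nz {w} w∈ with vertex w
  ... | old′ x = Mj⊆Nz (lookup⇒[]= x (M j) (trans (sym (adj-new-old j x)) (∈nbhd⁻ E w∈)))
  ... | new′ k = contradiction (trans (sym (∈nbhd⁻ E w∈)) (adj-new-new j k)) λ ()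

  M-injective : ¬ Sperner E → Injective _≡_ _≡_ M
  M-injective ¬sperner {j} {k} Mj≡Mk = decidable-stable (j ≟ k) λ j≢k →
    ¬sperner (new j , new k , j≢k ∘ new-injective , nbhd-new⊆ λ {x} x∈Mj →
      ∈nbhd⁺ E (trans (adj-new-old k x) ([]=⇒lookup (subst (x ∈_) Mj≡Mk x∈Mj))))

  M≢nbhd : ¬ Sperner E → ∀ j v → M j ≢ nbhd H v
  M≢nbhd ¬sperner j v Mj≡Nv =
    ¬sperner (new j , old v , old≢new v j ∘ sym , nbhd-new⊆ λ {x} x∈Mj →
      ∈nbhd⁺ E (trans (adj-old-old v x) (∈nbhd⁻ H (subst (x ∈_) Mj≡Nv x∈Mj))))

  M-K3Free : ωLess E 4 → ∀ j → K3Free H (M j)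
  M-K3Free ω<4 j S S⊆Mj S-clique ∣S∣≡3 = <-irrefl ∣S++j∣≡4 (ω<4 (S ++ ⁅ j ⁆) S++j-clique)
    where
    S++j-clique : IsClique E (S ++ ⁅ j ⁆)
    S++j-clique = clique⁺ S-clique (⁅x⁆-atMostOne j) λ x∈S k∈⁅j⁆ →
      subst (_ ∈_) (cong M (sym (x∈⁅y⁆⇒x≡y j k∈⁅j⁆))) (S⊆Mj x∈S)
    ∣S++j∣≡4 : ∣ S ++ ⁅ j ⁆ ∣ ≡ 4
    ∣S++j∣≡4 = trans (∣p++q∣≡∣p∣+∣q∣ S ⁅ j ⁆) (cong₂ _+_ ∣S∣≡3 (∣⁅x⁆∣≡1 j))

  M-maximal : ωLess E 4 → AllNonEdgesω4 E → ∀ j M′ → M j ⊆ M′ → K3Free H M′ → M′ ⊆ M j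
  M-maximal ω<4 saturated j M′ Mj⊆M′ M′-K3-free {x} x∈M′ with x ∈? M j
  ... | yes x∈Mj = x∈Mj
  ... | no  x∉Mj with commonEdge-new (nonEdge⇒commonEdge ω<4 saturated (old≢new x j)
                        (trans (adj-old-new x j) (¬-not (x∉Mj ∘ lookup⇒[]= x (M j)))))
  ...   | y , z , y~z , y∈Mj , z∈Mj , y~x , z~x =
    contradiction (∣triangle∣≡3 H x~y x~z y~z)
      (M′-K3-free (triangle x y z) (triangle⊆ x∈M′ (Mj⊆M′ y∈Mj) (Mj⊆M′ z∈Mj)) (triangle-clique H x~y x~z y~z))
    where
    x~y = adj-sym H (trans (sym (adj-old-old y x)) y~x)
    x~z = adj-sym H (trans (sym (adj-old-old z x)) z~x)

  M∩M-hasEdge : ωLess E 4 → AllNonEdgesω4 E → ∀ {r} → Arrows E (twos3 (suc r)) → ∀ j k → HasEdgeIn H (M j ∩ M k)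
  M∩M-hasEdge ω<4 saturated E→2ᵣ₊₁3 j k with j ≟ k
  ... | no j≢k with commonEdge-new (nonEdge⇒commonEdge ω<4 saturated (j≢k ∘ new-injective ∘ sym) (adj-new-new k j))
  ...   | y , z , y~z , y∈Mj , z∈Mj , y~k , z~k = y , z ,
    x∈p∩q⁺ (y∈Mj , lookup⇒[]= y (M k) (trans (sym (adj-old-new y k)) y~k)) ,
    x∈p∩q⁺ (z∈Mj , lookup⇒[]= z (M k) (trans (sym (adj-old-new z k)) z~k)) , y~z
  M∩M-hasEdge ω<4 saturated E→2ᵣ₊₁3 j k | yes refl with nonNeighbour {G = E} ω<4 E→2ᵣ₊₁3 (new j)
  ... | w , w≢j , j≁w with commonEdge-new (nonEdge⇒commonEdge ω<4 saturated w≢j (trans (Graph.sym E w (new j)) j≁w))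
  ...   | y , z , y~z , y∈Mj , z∈Mj , _ = y , z , x∈p∩q⁺ (y∈Mj , y∈Mj) , x∈p∩q⁺ (z∈Mj , z∈Mj) , y~z

  M-αBound : ∀ {k} → αLeq E k → ∀ (I : Subset s) → αInLeq H (∁ (unionOver M I)) (k ∸ ∣ I ∣)
  M-αBound α≤k I S S⊆∁∪ S-indep = m+n≤o⇒m≤o∸n ∣ S ∣ (subst (_≤ _) (∣p++q∣≡∣p∣+∣q∣ S I)
    (α≤k (S ++ I) (independent⁺ S-indep λ x∈S j∈I x∈Mj →
      x∈∁p⇒x∉p (S⊆∁∪ x∈S) (∈unionOver⁺ {M = M} j∈I x∈Mj))))

  extend-target : ∀ {r} → ωLess H 4 → (∀ j → K3Free H (M j)) →
    (∀ (I : Subset s) → αInLeq H (∁ (unionOver M I)) (s ∸ ∣ I ∣)) → Survives r E → Target r s E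
  extend-target ω<4 Mⱼ-K3-free α-bound (¬sperner , saturated , E→2ᵣ3) =
    ((E→2ᵣ3 , ωLess-extend ω<4 Mⱼ-K3-free) , saturated) , ¬sperner , αIs-extend α-bound

  target⇒InA : ∀ {r} → Target (suc r) s E → PlusK3 H × InHv (twos3 r) 4 H × αLeq H s
  target⇒InA (((E→2ᵣ₊₁3 , ω<4) , saturated) , _ , (_ , α≤s)) =
    PlusK3-restrict ω<4 saturated , (Arrows-restrict E→2ᵣ₊₁3 , ωLess-restrict ω<4) , αLeq-restrict α≤s

  target⇒admissible : ∀ {r} → Target (suc r) s E → Admissible s H M
  target⇒admissible (((E→2ᵣ₊₁3 , ω<4) , saturated) , ¬sperner , (_ , α≤s)) =
    M-injective ¬sperner ,
    (λ j → M-K3Free ω<4 j , M-maximal ω<4 saturated j) ,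
    M≢nbhd ¬sperner ,
    M∩M-hasEdge ω<4 saturated E→2ᵣ₊₁3 ,
    M-αBound α≤s

-- Splitting a graph along an independent set

module Decomposition (G : Graph n) (A : Subset n) where

  rest : Graph ∣ ∁ A ∣
  rest = record
    { adj    = λ x y → adj G (merge A (inj₁ x)) (merge A (inj₁ y))
    ; sym    = λ x y → Graph.sym G _ _
    ; irrefl = λ x → irrefl G _
    }

  links : Fin ∣ A ∣ → Subset ∣ ∁ A ∣
  links j = tabulate (λ x → adj G (merge A (inj₂ j)) (merge A (inj₁ x)))

  open Extension rest links

  decompose : IsIndependent G A → Iso G E
  decompose A-indep = ↔-trans (Fin↔∁p⊎p A) (↔-sym Fin.+↔⊎) , λ x y →
    trans (adj-join (separate A x) (separate A y)) (cong₂ (adj G) (merge∘separate A x) (merge∘separate A y))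
    where
    adj-join : ∀ p q → adj E (join _ _ p) (join _ _ q) ≡ adj G (merge A p) (merge A q)
    adj-join (inj₁ x) (inj₁ y) = adj-old-old x y
    adj-join (inj₁ x) (inj₂ j) = trans (adj-old-new x j) (trans (lookup∘tabulate _ x) (Graph.sym G _ _))
    adj-join (inj₂ j) (inj₁ x) = trans (adj-new-old j x) (lookup∘tabulate _ x)
    adj-join (inj₂ j) (inj₂ k) = trans (adj-new-new j k) (sym (A-indep _ _ (merge-inside A j) (merge-inside A k)))

independent-split : (G : Graph n) (A : Subset n) → IsIndependent G A → ∣ A ∣ ≡ s →
  Σ (Graph (n ∸ s)) λ H → Σ (Fin s → Subset (n ∸ s)) λ M → Iso G (extend H M)
independent-split {n} G A A-indep refl = retype (∣∁p∣≡n∸∣p∣ A) rest links (decompose A-indep)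
  where
  open Decomposition G A
  retype : ∀ {c} → c ≡ n ∸ ∣ A ∣ → (H : Graph c) (M : Fin ∣ A ∣ → Subset c) → Iso G (extend H M) →
           Σ (Graph (n ∸ ∣ A ∣)) λ H → Σ (Fin ∣ A ∣ → Subset (n ∸ ∣ A ∣)) λ M → Iso G (extend H M)
  retype refl H M iso = H , M , iso

soundness : ∀ n r s → 1 ≤ n → (H : Graph (n ∸ s)) (M : Fin s → Subset (n ∸ s)) →
  InA n r s H → Admissible s H M → Survives r (extend H M) →
  Σ (Graph n) λ G → Iso (extend H M) G × Target r s G
-- Since n ∸ s truncates, (n ∸ s) + s ≡ n needs s ≤ n, which holds because the s members of N
-- are distinct subsets of V(H).
soundness n r s 1≤n H M (_ , (_ , ω<4) , _) (M-inj , M-max , _ , _ , α-bound) survives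
  with Iso-cast (m∸n+n≡m (injective⇒s≤n 1≤n M M-inj)) (extend H M)
... | G , iso =
  G , iso , Target-resp-Iso {G = extend H M} {G} iso (Extension.extend-target H M ω<4 (proj₁ ∘ M-max) α-bound survives)

completeness : ∀ n r s (G : Graph n) → Target (suc r) s G →
  Σ (Graph (n ∸ s)) λ H → Σ (Fin s → Subset (n ∸ s)) λ M →
    InA n (suc r) s H × Admissible s H M × Survives (suc r) (extend H M) × Iso G (extend H M)
completeness n r s G target@(_ , _ , ((A , A-indep , ∣A∣≡s) , _)) with independent-split G A A-indep ∣A∣≡s
... | H , M , iso =
  H , M , target⇒InA {r = r} target′ , target⇒admissible {r = r} target′ ,
  target⇒survives {r = suc r} {G = E} target′ , iso
  where
  open Extension H M
  target′ : Target (suc r) s E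
  target′ = Target-resp-Iso {G = G} {E} iso {r = suc r} target

mainTheorem6 : (n r s : ℕ) → 1 ≤ n → 1 ≤ r → 1 ≤ s →
    ((H : Graph (n ∸ s)) (M : Fin s → Subset (n ∸ s)) →
      InA n r s H → Admissible s H M → Survives r (extend H M) →
      Σ (Graph n) λ G → Iso (extend H M) G × Target r s G)
    ×
    ((G : Graph n) → Target r s G →
      Σ (Graph (n ∸ s)) λ H → Σ (Fin s → Subset (n ∸ s)) λ M →
        InA n r s H × Admissible s H M × Survives r (extend H M)
        × Iso G (extend H M))
mainTheorem6 n (suc r) s 1≤n _ _ = soundness n (suc r) s 1≤n , completeness n r s
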